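{- Let $z \ge 0$ be an integer and let $n>1$ be an odd composite integer. Then $n$ is a $z$-deep Carmichael number if and only if $n$ is squarefree and, for every prime $p$ dividing $n$, $2^z(p-1)$ divides $n-1$ (i.e. $(p-1) \mid \frac{n-1}{2^z}$).
   Context: The $z$-deep Miller–Rabin test. Let $n$ be an odd integer $>1$, write $n-1 = 2^r d$ with $d$ odd, and let $a$ be an integer coprime to $n$. Consider the sequence of residues modulo $n$: $a^{d}, a^{2d}, \dots, a^{2^{r-1}d}, a^{2^r d}$. The $z$-deep test with base $a$ looks only at the last $z+1$ terms of this sequence, i.e. at $a^{2^i d} \bmod n$ for $\max(0,r-z) \le i \le r$ (all terms if $r<z$). It declares $n$ "probably prime" (i.e. $n$ passes for base $a$) if $1$ appears among these considered terms and its first occurrence among them is either the first considered term or is immediately preceded by the term $-1 \pmod n$; otherwise it declares $n$ "composite". (For $z=0$ this is the Fermat test $a^{n-1}\equiv 1 \pmod n$.) An odd composite integer $n$ is a $z$-deep Carmichael number if it passes the $z$-deep test for every base $a \in (\mathbb{Z}/n\mathbb{Z})^*$. The divisibility condition $(p-1)\mid \frac{n-1}{2^z}$ is understood as $2^z(p-1) \mid n-1$. -}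

module Defs where

open import Data.Nat using (ℕ; zero; suc; _+_; _*_; _∸_; _^_; _≤_; _<_; NonZero)
open import Data.Nat.DivMod using (_%_)
open import Data.Nat.Divisibility using (_∣_)
open import Data.Nat.Primality using (Prime; Composite)
open import Data.Nat.Coprimality using (Coprime)
open import Data.Product using (Σ; _×_)
open import Data.Sum using (_⊎_)
open import Relation.Nullary using (¬_)
open import Relation.Binary.PropositionalEquality using (_≡_; _≢_)

Odd : ℕ → Set
Odd m = m % 2 ≡ 1

mrTerm : (n : ℕ) .{{_ : NonZero n}} → (a d i : ℕ) → ℕ
mrTerm n a d i = (a ^ (2 ^ i * d)) % n

-- z-deep test with base a, given the decomposition n - 1 = 2^r d.
-- Considered indices: s ≤ i ≤ r with s = r ∸ z  (= max(0, r - z)).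
-- n passes iff there is an index i in [s, r] with term i ≡ 1 (mod n),
-- no earlier considered index j (s ≤ j < i) has term ≡ 1, and either
-- i = s or term (i-1) ≡ -1 (mod n), i.e. equals n - 1 as a residue.
PassesDeep : (z n : ℕ) .{{_ : NonZero n}} → (r d a : ℕ) → Set
PassesDeep z n r d a =
  Σ ℕ λ i →
    (r ∸ z ≤ i) × (i ≤ r)
    × (mrTerm n a d i ≡ 1 % n)
    × (∀ j → r ∸ z ≤ j → j < i → mrTerm n a d j ≢ 1 % n)
    × ((i ≡ r ∸ z) ⊎ (mrTerm n a d (i ∸ 1) ≡ (n ∸ 1) % n))

-- n is a z-deep Carmichael number: odd composite, and for the
-- decomposition n - 1 = 2^r d (d odd), n passes the z-deep test for
-- every base a in (Z/nZ)^*, represented by 1 ≤ a < n with gcd(a,n)=1.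
DeepCarmichael : (z n : ℕ) .{{_ : NonZero n}} → Set
DeepCarmichael z n =
  Odd n × Composite n ×
  (∀ r d → n ∸ 1 ≡ 2 ^ r * d → Odd d →
     ∀ a → 1 ≤ a → a < n → Coprime a n → PassesDeep z n r d a)

SquareFree : ℕ → Set
SquareFree m = ∀ p → Prime p → ¬ (p * p ∣ m)

module Submission where

-- Write n − 1 = 2^r d with d odd and put e = 2^(r∸z) d, the exponent of the
-- first term a^e inspected by the test.  For an odd prime p the condition
-- 2^z (p − 1) ∣ 2^r d is equivalent to (p − 1) ∣ e.
--
-- (⇐) By Fermat a^e ≡ 1 modulo every prime factor of n, hence modulo the
--     squarefree n, so the test succeeds at its first term.
-- (⇒) Squarefree: if p² ∣ n, the unit 1 + n/p satisfies (1 + n/p)^K ≡ 1 + K·n/p,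
--     so a term ≡ 1 forces p ∣ K ∣ n − 1, impossible.  Divisibility: write
--     n = m p with p ∤ m, m ≥ 3.  For 0 < x < p the Chinese-remainder base
--     a ≡ x (mod p), a ≡ 1 (mod m) has no term ≡ −1 (mod n), so the test must
--     succeed at its first term and x^e ≡ 1 (mod p).  Since this holds for every
--     nonzero residue x, a power-sum argument gives (p − 1) ∣ e.

open import Defs
open import Data.Nat using (ℕ; _*_; _∸_; _^_; _<_; NonZero)
open import Data.Nat.Divisibility using (_∣_)
open import Data.Nat.Primality using (Prime; Composite)
open import Data.Product using (_×_)
open import Function.Bundles using (_⇔_)

open import Data.Nat
open import Data.Nat.Properties
open import Data.Nat.Divisibility
open import Data.Nat.DivMod
open import Data.Nat.Induction using (<-rec)
open import Data.Nat.Primality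
  using (prime⇒nonTrivial; prime⇒nonZero; prime⇒irreducible; euclidsLemma; composite⇒¬prime)
open import Data.Nat.Primality.Factorisation using (factorise)
open import Data.Nat.Coprimality using (Coprime; coprime-divisor)
open import Data.Nat.ListAction using (product)
open import Data.List using ([]; _∷_)
open import Data.List.Relation.Unary.All using (_∷_)
open import Data.Product using (Σ; _,_)
open import Data.Sum using (_⊎_; inj₁; inj₂)
open import Data.Empty using (⊥-elim)
open import Relation.Nullary using (¬_; yes; no)
open import Relation.Binary.PropositionalEquality
open import Function.Bundles using (mk⇔)
open import Data.Nat.Solver using (module +-*-Solver)
open +-*-Solver
open ≡-Reasoning

sumTo : ℕ → (ℕ → ℕ) → ℕ
sumTo zero    f = 0
sumTo (suc n) f = sumTo n f + f n

sum-cong : ∀ n {f g : ℕ → ℕ} → (∀ i → i < n → f i ≡ g i) → sumTo n f ≡ sumTo n g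
sum-cong zero    f≡g = refl
sum-cong (suc n) f≡g =
  cong₂ _+_ (sum-cong n (λ i i<n → f≡g i (m<n⇒m<1+n i<n))) (f≡g n ≤-refl)

sum-shift : ∀ n (f : ℕ → ℕ) → sumTo (suc n) f ≡ f 0 + sumTo n (λ i → f (suc i))
sum-shift zero    f = sym (+-identityʳ (f 0))
sum-shift (suc n) f = begin
  sumTo (suc n) f + f (suc n)                  ≡⟨ cong (_+ f (suc n)) (sum-shift n f) ⟩
  f 0 + sumTo n (λ i → f (suc i)) + f (suc n)  ≡⟨ +-assoc (f 0) _ _ ⟩
  f 0 + (sumTo n (λ i → f (suc i)) + f (suc n)) ∎

sum-+ : ∀ n (f g : ℕ → ℕ) → sumTo n (λ i → f i + g i) ≡ sumTo n f + sumTo n g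
sum-+ zero    f g = refl
sum-+ (suc n) f g = begin
  sumTo n (λ i → f i + g i) + (f n + g n) ≡⟨ cong (_+ (f n + g n)) (sum-+ n f g) ⟩
  sumTo n f + sumTo n g + (f n + g n)     ≡⟨ solve 4 (λ a b c d → a :+ b :+ (c :+ d) := a :+ c :+ (b :+ d))
                                                      refl (sumTo n f) (sumTo n g) (f n) (g n) ⟩
  sumTo n f + f n + (sumTo n g + g n)     ∎

sum-* : ∀ n c (f : ℕ → ℕ) → sumTo n (λ i → c * f i) ≡ c * sumTo n f
sum-* zero    c f = sym (*-zeroʳ c)
sum-* (suc n) c f = begin
  sumTo n (λ i → c * f i) + c * f n ≡⟨ cong (_+ c * f n) (sum-* n c f) ⟩
  c * sumTo n f + c * f n           ≡⟨ sym (*-distribˡ-+ c _ _) ⟩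
  c * (sumTo n f + f n)             ∎

sum-zero : ∀ n → sumTo n (λ _ → 0) ≡ 0
sum-zero zero    = refl
sum-zero (suc n) = cong (_+ 0) (sum-zero n)

sum-swap : ∀ n m (f : ℕ → ℕ → ℕ) →
           sumTo n (λ i → sumTo m (λ j → f i j)) ≡ sumTo m (λ j → sumTo n (λ i → f i j))
sum-swap zero    m f = sym (sum-zero m)
sum-swap (suc n) m f = begin
  sumTo n (λ i → sumTo m (λ j → f i j)) + sumTo m (λ j → f n j)
    ≡⟨ cong (_+ sumTo m (λ j → f n j)) (sum-swap n m f) ⟩
  sumTo m (λ j → sumTo n (λ i → f i j)) + sumTo m (λ j → f n j)
    ≡⟨ sym (sum-+ m _ _) ⟩
  sumTo m (λ j → sumTo n (λ i → f i j) + f n j) ∎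

sum-∣ : ∀ n {d} (f : ℕ → ℕ) → (∀ i → i < n → d ∣ f i) → d ∣ sumTo n f
sum-∣ zero    f d∣f = _ ∣0
sum-∣ (suc n) f d∣f = ∣m∣n⇒∣m+n (sum-∣ n f (λ i i<n → d∣f i (m<n⇒m<1+n i<n))) (d∣f n ≤-refl)

sum-ones-mod : ∀ {k} .{{_ : NonZero k}} N (f : ℕ → ℕ) →
               (∀ i → i < N → f i % k ≡ 1 % k) → sumTo N f % k ≡ N % k
sum-ones-mod     zero    f f≡1 = refl
sum-ones-mod {k} (suc N) f f≡1 = begin
  (sumTo N f + f N) % k         ≡⟨ %-distribˡ-+ (sumTo N f) (f N) k ⟩
  (sumTo N f % k + f N % k) % k ≡⟨ cong₂ (λ a b → (a + b) % k)
                                     (sum-ones-mod N f (λ i i<N → f≡1 i (m<n⇒m<1+n i<N))) (f≡1 N ≤-refl) ⟩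
  (N % k + 1 % k) % k           ≡⟨ sym (%-distribˡ-+ N 1 k) ⟩
  (N + 1) % k                   ≡⟨ cong (_% k) (+-comm N 1) ⟩
  suc N % k                     ∎

choose : ℕ → ℕ → ℕ
choose n       zero    = 1
choose zero    (suc k) = 0
choose (suc n) (suc k) = choose n k + choose n (suc k)

choose-> : ∀ n k → n < k → choose n k ≡ 0
choose-> zero    (suc k) _         = refl
choose-> (suc n) (suc k) (s≤s n<k) = cong₂ _+_ (choose-> n k n<k) (choose-> n (suc k) (m<n⇒m<1+n n<k))

choose-diag : ∀ n → choose n n ≡ 1
choose-diag zero    = refl
choose-diag (suc n) = cong₂ _+_ (choose-diag n) (choose-> n (suc n) ≤-refl)

choose-subdiag : ∀ n → choose (suc n) n ≡ suc n
choose-subdiag zero    = refl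
choose-subdiag (suc n) = begin
  choose (suc n) n + choose (suc n) (suc n) ≡⟨ cong₂ _+_ (choose-subdiag n) (choose-diag (suc n)) ⟩
  suc n + 1                                 ≡⟨ +-comm (suc n) 1 ⟩
  suc (suc n)                               ∎

-- Absorption: (k+1)·C(n+1, k+1) = (n+1)·C(n, k).  It shows p ∣ C(p, j) for 0 < j < p.
choose-absorb : ∀ n k → suc k * choose (suc n) (suc k) ≡ suc n * choose n k
choose-absorb zero    zero    = refl
choose-absorb zero    (suc k) = *-zeroʳ (suc (suc k))
choose-absorb (suc n) zero    = begin
  1 * (choose (suc n) 0 + choose (suc n) 1) ≡⟨ *-identityˡ _ ⟩
  1 + choose (suc n) 1                      ≡⟨ cong suc (trans (sym (*-identityˡ _)) (choose-absorb n 0)) ⟩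
  1 + suc n * 1                             ≡⟨ cong suc (*-identityʳ (suc n)) ⟩
  suc (suc n)                               ≡⟨ sym (*-identityʳ _) ⟩
  suc (suc n) * 1                           ∎
choose-absorb (suc n) (suc k) = begin
  K * (A + B)                                          ≡⟨ *-distribˡ-+ K A B ⟩
  K * A + K * B                                        ≡⟨ cong (K * A +_) (choose-absorb n (suc k)) ⟩
  (A + suc k * A) + suc n * choose n (suc k)           ≡⟨ cong (λ t → (A + t) + suc n * choose n (suc k))
                                                               (choose-absorb n k) ⟩
  (A + suc n * choose n k) + suc n * choose n (suc k)  ≡⟨ +-assoc A _ _ ⟩
  A + (suc n * choose n k + suc n * choose n (suc k))  ≡⟨ cong (A +_) (sym (*-distribˡ-+ (suc n) (choose n k) (choose n (suc k)))) ⟩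
  A + suc n * A                                        ∎
  where
  K A B : ℕ
  K = suc (suc k)
  A = choose (suc n) (suc k)
  B = choose (suc n) (suc (suc k))

binomial : ∀ n x → suc x ^ n ≡ sumTo (suc n) (λ j → choose n j * x ^ j)
binomial zero    x = refl
binomial (suc n) x = begin
  suc x ^ n + x * suc x ^ n                                  ≡⟨ cong₂ (λ a b → a + x * b) lower (binomial n x) ⟩
  (1 + A) + x * sumTo (suc n) (λ j → choose n j * x ^ j)    ≡⟨ cong ((1 + A) +_) (sym (sum-* (suc n) x _)) ⟩
  (1 + A) + B                                                ≡⟨ cong (λ t → (1 + t) + B) top-zero ⟩
  (1 + A′) + B                                               ≡⟨ solve 2 (λ a b → (con 1 :+ a) :+ b := con 1 :+ (b :+ a))
                                                                      refl A′ B ⟩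
  1 + (B + A′)                                               ≡⟨ cong (1 +_) (sym (sum-+ (suc n) _ _)) ⟩
  1 + sumTo (suc n) (λ j → x * (choose n j * x ^ j) + choose n (suc j) * x ^ suc j)
                                                             ≡⟨ cong (1 +_) (sum-cong (suc n) (λ j _ → pascal j)) ⟩
  1 + sumTo (suc n) (λ j → choose (suc n) (suc j) * x ^ suc j)
                                                             ≡⟨ sym (sum-shift (suc n) (λ j → choose (suc n) j * x ^ j)) ⟩
  sumTo (suc (suc n)) (λ j → choose (suc n) j * x ^ j)       ∎
  where
  A A′ B : ℕ
  A  = sumTo n (λ j → choose n (suc j) * x ^ suc j)
  A′ = sumTo (suc n) (λ j → choose n (suc j) * x ^ suc j)
  B  = sumTo (suc n) (λ j → x * (choose n j * x ^ j))
  lower : suc x ^ n ≡ 1 + A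
  lower = trans (binomial n x) (sum-shift n (λ j → choose n j * x ^ j))
  top-zero : A ≡ A′
  top-zero = trans (sym (+-identityʳ A))
                   (cong (λ t → A + t * x ^ suc n) (sym (choose-> n (suc n) ≤-refl)))
  pascal : ∀ j → x * (choose n j * x ^ j) + choose n (suc j) * x ^ suc j
               ≡ choose (suc n) (suc j) * x ^ suc j
  pascal j = solve 4 (λ x a b y → x :* (a :* y) :+ b :* (x :* y) := (a :+ b) :* (x :* y))
                     refl x (choose n j) (choose n (suc j)) (x ^ j)

+-cong-mod : ∀ {N} .{{_ : NonZero N}} c {a b} → a % N ≡ b % N → (c + a) % N ≡ (c + b) % N
+-cong-mod {N} c {a} {b} a≡b = begin
  (c + a) % N           ≡⟨ %-distribˡ-+ c a N ⟩
  (c % N + a % N) % N   ≡⟨ cong (λ t → (c % N + t) % N) a≡b ⟩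
  (c % N + b % N) % N   ≡⟨ sym (%-distribˡ-+ c b N) ⟩
  (c + b) % N           ∎

*-cong-mod : ∀ {N} .{{_ : NonZero N}} c {a b} → a % N ≡ b % N → (c * a) % N ≡ (c * b) % N
*-cong-mod {N} c {a} {b} a≡b = begin
  (c * a) % N           ≡⟨ %-distribˡ-* c a N ⟩
  (c % N * (a % N)) % N ≡⟨ cong (λ t → (c % N * t) % N) a≡b ⟩
  (c % N * (b % N)) % N ≡⟨ sym (%-distribˡ-* c b N) ⟩
  (c * b) % N           ∎

*-one-mod : ∀ {N} .{{_ : NonZero N}} {c} a → c % N ≡ 1 % N → (c * a) % N ≡ a % N
*-one-mod {N} {c} a c≡1 = begin
  (c * a) % N           ≡⟨ trans (cong (_% N) (*-comm c a)) (*-cong-mod a c≡1) ⟩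
  (a * 1) % N           ≡⟨ cong (_% N) (*-identityʳ a) ⟩
  a % N                 ∎

^-%-absorb : ∀ {N} .{{_ : NonZero N}} a k → (a % N) ^ k % N ≡ a ^ k % N
^-%-absorb     a zero    = refl
^-%-absorb {N} a (suc k) = begin
  (a % N * (a % N) ^ k) % N          ≡⟨ %-distribˡ-* (a % N) _ N ⟩
  (a % N % N * ((a % N) ^ k % N)) % N ≡⟨ cong₂ (λ u v → (u * v) % N) (m%n%n≡m%n a N) (^-%-absorb a k) ⟩
  (a % N * (a ^ k % N)) % N          ≡⟨ sym (%-distribˡ-* a _ N) ⟩
  (a * a ^ k) % N                    ∎

^-cong-mod : ∀ {N} .{{_ : NonZero N}} {a b} k → a % N ≡ b % N → a ^ k % N ≡ b ^ k % N
^-cong-mod {N} {a} {b} k a≡b =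
  trans (sym (^-%-absorb a k)) (trans (cong (λ t → t ^ k % N) a≡b) (^-%-absorb b k))

^-one-mod : ∀ {N} .{{_ : NonZero N}} {a} k → a % N ≡ 1 % N → a ^ k % N ≡ 1 % N
^-one-mod {N} k a≡1 = trans (^-cong-mod k a≡1) (cong (_% N) (^-zeroˡ k))

^-mod-order : ∀ {N} .{{_ : NonZero N}} {y} k .{{_ : NonZero k}} e →
              y ^ k % N ≡ 1 % N → y ^ e % N ≡ y ^ (e % k) % N
^-mod-order {N} {y} k e yᵏ≡1 = begin
  y ^ e % N                             ≡⟨ cong (λ t → y ^ t % N) (m≡m%n+[m/n]*n e k) ⟩
  y ^ (e % k + e / k * k) % N           ≡⟨ cong (_% N) (^-distribˡ-+-* y (e % k) (e / k * k)) ⟩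
  (y ^ (e % k) * y ^ (e / k * k)) % N   ≡⟨ cong (λ t → (y ^ (e % k) * t) % N) power-of-order ⟩
  (y ^ (e % k) * (y ^ k) ^ (e / k)) % N ≡⟨ cong (_% N) (*-comm (y ^ (e % k)) _) ⟩
  ((y ^ k) ^ (e / k) * y ^ (e % k)) % N ≡⟨ *-one-mod (y ^ (e % k)) (^-one-mod (e / k) yᵏ≡1) ⟩
  y ^ (e % k) % N                       ∎
  where
  power-of-order : y ^ (e / k * k) ≡ (y ^ k) ^ (e / k)
  power-of-order = trans (cong (y ^_) (*-comm (e / k) k)) (sym (^-*-assoc y k (e / k)))

^-order-∣ : ∀ {N} .{{_ : NonZero N}} {y} k .{{_ : NonZero k}} {e} →
            y ^ k % N ≡ 1 % N → k ∣ e → y ^ e % N ≡ 1 % N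
^-order-∣ {N} {y} k {e} yᵏ≡1 k∣e =
  trans (^-mod-order k e yᵏ≡1) (cong (λ t → y ^ t % N) (n∣m⇒m%n≡0 e k k∣e))

≡-mod⇒∣∸ : ∀ {N} .{{_ : NonZero N}} {a b} → a % N ≡ b % N → N ∣ a ∸ b
≡-mod⇒∣∸ {N} {a} {b} a≡b = divides (a / N ∸ b / N) (begin
  a ∸ b                                     ≡⟨ cong₂ _∸_ (m≡m%n+[m/n]*n a N) (m≡m%n+[m/n]*n b N) ⟩
  (a % N + a / N * N) ∸ (b % N + b / N * N) ≡⟨ cong (λ t → (t + a / N * N) ∸ (b % N + b / N * N)) a≡b ⟩
  (b % N + a / N * N) ∸ (b % N + b / N * N) ≡⟨ [m+n]∸[m+o]≡n∸o (b % N) _ _ ⟩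
  a / N * N ∸ b / N * N                     ≡⟨ sym (*-distribʳ-∸ N (a / N) (b / N)) ⟩
  (a / N ∸ b / N) * N                       ∎)

∣∸⇒≡-mod : ∀ {N} .{{_ : NonZero N}} {a b} → b ≤ a → N ∣ a ∸ b → a % N ≡ b % N
∣∸⇒≡-mod {N} {a} {b} b≤a (divides k a∸b≡kN) = begin
  a % N             ≡⟨ cong (_% N) (sym (m+[n∸m]≡n b≤a)) ⟩
  (b + (a ∸ b)) % N ≡⟨ cong (λ t → (b + t) % N) a∸b≡kN ⟩
  (b + k * N) % N   ≡⟨ [m+kn]%n≡m%n b k N ⟩
  b % N             ∎

pred-mod-divisor : ∀ {m n} .{{_ : NonZero m}} → 0 < n → m ∣ n → (n ∸ 1) % m ≡ m ∸ 1
pred-mod-divisor {m} {n} 0<n m∣n =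
  %-pred-≡0 (subst (λ k → k % m ≡ 0) (sym suc-pred-n) (n∣m⇒m%n≡0 n m m∣n))
  where
  suc-pred-n : suc (n ∸ 1) ≡ n
  suc-pred-n = trans (+-comm 1 (n ∸ 1)) (m∸n+n≡m 0<n)

prime>1 : ∀ {p} → Prime p → 1 < p
prime>1 {p} pp = nonTrivial⇒n>1 p {{prime⇒nonTrivial pp}}

prime-suc : ∀ {p} → Prime p → Σ ℕ λ q → p ≡ suc q
prime-suc {suc q} _  = q , refl
prime-suc {zero}  pp with () ← prime>1 pp

prime-factor : ∀ n → 1 < n → Σ ℕ λ p → Prime p × p ∣ n
prime-factor n 1<n with factorise n {{>-nonZero (<-trans z<s 1<n)}}
... | record { factors = [] ; isFactorisation = n≡1 } = ⊥-elim (<⇒≢ 1<n (sym n≡1))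
... | record { factors = p ∷ ps ; isFactorisation = n≡∏ ; factorsPrime = p-prime ∷ _ } =
  p , p-prime , divides (product ps) (trans n≡∏ (*-comm p _))

∣⇒∤pred : ∀ {p n} → Prime p → p ∣ n → 0 < n → ¬ p ∣ n ∸ 1
∣⇒∤pred {p} {n} pp p∣n 0<n p∣n-1 =
  <⇒≢ (prime>1 pp) (sym (∣1⇒≡1 (∣m+n∣m⇒∣n (subst (p ∣_) (sym (m∸n+n≡m 0<n)) p∣n) p∣n-1)))

coprime-* : ∀ {a m k} → Coprime a m → Coprime a k → Coprime a (m * k)
coprime-* {a} {m} {k} a⊥m a⊥k {i} (i∣a , i∣mk) =
  a⊥m (i∣a , coprime-divisor i⊥k (subst (i ∣_) (*-comm m k) i∣mk))
  where
  i⊥k : Coprime i k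
  i⊥k (j∣i , j∣k) = a⊥k (∣-trans j∣i i∣a , j∣k)

≡1-mod⇒coprime : ∀ {a m} .{{_ : NonZero m}} → a % m ≡ 1 % m → Coprime a m
≡1-mod⇒coprime a≡1 (i∣a , i∣m) = ∣1⇒≡1 (∣n∣m%n⇒∣m i∣m (subst (_ ∣_) a≡1 (%-presˡ-∣ i∣a i∣m)))

∤⇒coprime : ∀ {p a} → Prime p → ¬ p ∣ a → Coprime a p
∤⇒coprime pp p∤a (i∣a , i∣p) with prime⇒irreducible pp i∣p
... | inj₁ i≡1 = i≡1
... | inj₂ refl = ⊥-elim (p∤a i∣a)

-- Fermat's little theorem for the prime p = q + 1, via the Frobenius map x ↦ x^p.
module Frobenius (q : ℕ) (pp : Prime (suc q)) where
  private
    p = suc q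

  p∣choose : ∀ j → j < q → p ∣ choose p (suc j)
  p∣choose j j<q with euclidsLemma (suc j) (choose p (suc j)) pp
                        (divides (choose q j) (trans (choose-absorb q j) (*-comm p (choose q j))))
  ... | inj₁ p∣j+1 = ⊥-elim (<⇒≱ (s≤s j<q) (∣⇒≤ p∣j+1))
  ... | inj₂ p∣C  = p∣C

  freshman : ∀ x → suc x ^ p % p ≡ (1 + x ^ p) % p
  freshman x = begin
    suc x ^ p % p                          ≡⟨ cong (_% p) (trans (binomial p x) (sum-shift p (λ j → choose p j * x ^ j))) ⟩
    (1 + (M + choose p p * x ^ p)) % p     ≡⟨ cong (λ t → (1 + (M + t * x ^ p)) % p) (choose-diag p) ⟩
    (1 + (M + 1 * x ^ p)) % p              ≡⟨ cong (_% p) (solve 2 (λ m y → con 1 :+ (m :+ con 1 :* y) := (con 1 :+ y) :+ m)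
                                                                   refl M (x ^ p)) ⟩
    ((1 + x ^ p) + M) % p                  ≡⟨ %-remove-+ʳ (1 + x ^ p) (sum-∣ q _ (λ j j<q → ∣m⇒∣m*n (x ^ suc j) (p∣choose j j<q))) ⟩
    (1 + x ^ p) % p                        ∎
    where
    M : ℕ
    M = sumTo q (λ j → choose p (suc j) * x ^ suc j)

  frobenius : ∀ x → x ^ p % p ≡ x % p
  frobenius zero    = cong (_% p) (*-zeroˡ (0 ^ q))
  frobenius (suc x) = trans (freshman x) (+-cong-mod 1 {x ^ p} {x} (frobenius x))

  -- x^q ≡ 1 (mod p) for p ∤ x, since p ∣ x^p − x = x (x^q − 1).
  little-fermat : ∀ x → ¬ p ∣ x → x ^ q % p ≡ 1 % p
  little-fermat zero    p∤0 = ⊥-elim (p∤0 (p ∣0))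
  little-fermat (suc x) p∤x = ∣∸⇒≡-mod (m^n>0 (suc x) q) p∣xᵠ-1
    where
    p∣x[xᵠ-1] : p ∣ suc x * (suc x ^ q ∸ 1)
    p∣x[xᵠ-1] = subst (p ∣_)
      (trans (cong (suc x ^ p ∸_) (sym (*-identityʳ (suc x)))) (sym (*-distribˡ-∸ (suc x) (suc x ^ q) 1)))
      (≡-mod⇒∣∸ {a = suc x ^ p} {b = suc x} (frobenius (suc x)))
    p∣xᵠ-1 : p ∣ suc x ^ q ∸ 1
    p∣xᵠ-1 with euclidsLemma (suc x) _ pp p∣x[xᵠ-1]
    ... | inj₁ p∣x = ⊥-elim (p∤x p∣x)
    ... | inj₂ p∣xᵠ-1 = p∣xᵠ-1

fermat : ∀ {p a} .{{_ : NonZero p}} → Prime p → ¬ p ∣ a → a ^ (p ∸ 1) % p ≡ 1 % p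
fermat pp p∤a with prime-suc pp
... | q , refl = Frobenius.little-fermat q pp _ p∤a

module PowerSums (q : ℕ) (pp : Prime (suc q)) where
  private
    p = suc q

    instance
      q-nonZero : NonZero q
      q-nonZero = >-nonZero (≤-pred (prime>1 pp))

  S : ℕ → ℕ
  S g = sumTo p (λ x → x ^ g)

  -- Telescoping (x+1)^(g+1) − x^(g+1) over x < p:  Σ_{j≤g} C(g+1, j) S j = p^(g+1).
  S-binomial : ∀ g → sumTo (suc g) (λ j → choose (suc g) j * S j) ≡ p ^ suc g
  S-binomial g = +-cancelʳ-≡ _ _ _ (begin
    sumTo (suc g) T + S G                                 ≡⟨ cong (sumTo (suc g) T +_) (sym top) ⟩
    sumTo (suc G) T                                       ≡⟨ sym (sum-cong (suc G) (λ j _ → sum-* p (choose G j) (λ x → x ^ j))) ⟩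
    sumTo (suc G) (λ j → sumTo p (λ x → choose G j * x ^ j)) ≡⟨ sym (sum-swap p (suc G) (λ x j → choose G j * x ^ j)) ⟩
    sumTo p (λ x → sumTo (suc G) (λ j → choose G j * x ^ j)) ≡⟨ sym (sum-cong p (λ x _ → binomial G x)) ⟩
    sumTo p (λ x → suc x ^ G)                             ≡⟨ sym (sum-shift p (λ x → x ^ G)) ⟩
    S G + p ^ G                                           ≡⟨ +-comm (S G) _ ⟩
    p ^ G + S G                                           ∎)
    where
    G : ℕ
    G = suc g
    T : ℕ → ℕ
    T j = choose G j * S j
    top : T G ≡ S G
    top = trans (cong (_* S G) (choose-diag G)) (*-identityˡ (S G))

  -- p ∣ S g for g + 1 < p, by strong induction: S-binomial isolates (g+1)·S g.
  S-divisible : ∀ g → suc g < p → p ∣ S g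
  S-divisible = <-rec (λ g → suc g < p → p ∣ S g) step
    where
    step : ∀ g → (∀ {j} → j < g → suc j < p → p ∣ S j) → suc g < p → p ∣ S g
    step g rec g+1<p with euclidsLemma (suc g) (S g) pp p∣[g+1]S
      where
      lower : p ∣ sumTo g (λ j → choose (suc g) j * S j)
      lower = sum-∣ g _ (λ j j<g → ∣n⇒∣m*n (choose (suc g) j) (rec j<g (<-trans (s≤s j<g) g+1<p)))
      whole : p ∣ sumTo g (λ j → choose (suc g) j * S j) + choose (suc g) g * S g
      whole = subst (p ∣_) (sym (S-binomial g)) (m∣m*n (p ^ g))
      p∣[g+1]S : p ∣ suc g * S g
      p∣[g+1]S = subst (λ t → p ∣ t * S g) (choose-subdiag g) (∣m+n∣m⇒∣n whole lower)
    ... | inj₁ p∣g+1 = ⊥-elim (<⇒≱ g+1<p (∣⇒≤ p∣g+1))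
    ... | inj₂ p∣Sg  = p∣Sg

  -- With g = e mod q ≠ 0: Σ_{0<x<p} x^g ≡ S g ≡ 0 but also ≡ q (mod p).
  units-exponent : ∀ e → (∀ x → x < q → suc x ^ e % p ≡ 1 % p) → q ∣ e
  units-exponent e xᵉ≡1 with e % q in e%q≡
  ... | zero  = m%n≡0⇒n∣m e q e%q≡
  ... | suc g = ⊥-elim (≢-nonZero⁻¹ q (trans (sym (m<n⇒m%n≡m (n<1+n q))) (trans (sym sum≡q) sum≡0)))
    where
    xᵍ≡1 : ∀ x → x < q → suc x ^ suc g % p ≡ 1 % p
    xᵍ≡1 x x<q = begin
      suc x ^ suc g % p    ≡⟨ cong (λ t → suc x ^ t % p) (sym e%q≡) ⟩
      suc x ^ (e % q) % p  ≡⟨ sym (^-mod-order q e (fermat pp (λ p∣x → <⇒≱ (s≤s x<q) (∣⇒≤ p∣x)))) ⟩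
      suc x ^ e % p        ≡⟨ xᵉ≡1 x x<q ⟩
      1 % p                ∎
    sum≡q : sumTo q (λ x → suc x ^ suc g) % p ≡ q % p
    sum≡q = sum-ones-mod q _ xᵍ≡1
    sum≡0 : sumTo q (λ x → suc x ^ suc g) % p ≡ 0
    sum≡0 = trans (cong (_% p) (sym (sum-shift q (λ x → x ^ suc g))))
                  (n∣m⇒m%n≡0 _ p (S-divisible (suc g) (s≤s (subst (_< q) e%q≡ (m%n<n e q)))))

units-exponent : ∀ {p e} .{{_ : NonZero p}} → Prime p → (∀ x → 0 < x → x < p → x ^ e % p ≡ 1 % p) → p ∸ 1 ∣ e
units-exponent pp xᵉ≡1 with prime-suc pp
... | q , refl = PowerSums.units-exponent q pp _ (λ x x<q → xᵉ≡1 (suc x) z<s (s≤s x<q))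

squarefree-cofactor : ∀ {n m p} → SquareFree n → Prime p → n ≡ m * p → ¬ p ∣ m
squarefree-cofactor {p = p} sf pp n≡mp (divides u m≡up) =
  sf p pp (divides u (trans n≡mp (trans (cong (_* p) m≡up) (*-assoc u p p))))

prime-*-∣ : ∀ {M m p} → Prime p → ¬ p ∣ m → m ∣ M → p ∣ M → m * p ∣ M
prime-*-∣ {M} {m} {p} pp p∤m (divides t M≡tm) p∣M with euclidsLemma t m pp (subst (p ∣_) M≡tm p∣M)
... | inj₂ p∣m = ⊥-elim (p∤m p∣m)
... | inj₁ (divides u t≡up) = divides u (begin
  M           ≡⟨ M≡tm ⟩
  t * m       ≡⟨ cong (_* m) t≡up ⟩
  u * p * m   ≡⟨ solve 3 (λ u p m → u :* p :* m := u :* (m :* p)) refl u p m ⟩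
  u * (m * p) ∎)

squarefree-∣ : ∀ M n → 0 < n → SquareFree n → (∀ p → Prime p → p ∣ n → p ∣ M) → n ∣ M
squarefree-∣ M = <-rec P step
  where
  P : ℕ → Set
  P n = 0 < n → SquareFree n → (∀ p → Prime p → p ∣ n → p ∣ M) → n ∣ M
  step : ∀ n → (∀ {k} → k < n → P k) → P n
  step 1 _ _ _ _ = 1∣ M
  step n@(suc (suc _)) rec _ sf p∣M with prime-factor n (s≤s (s≤s z≤n))
  ... | p , pp , divides m n≡mp =
    subst (_∣ M) (sym n≡mp) (prime-*-∣ pp p∤m (rec m<n 0<m sf-m (λ p′ pp′ p′∣m → p∣M p′ pp′ (∣-trans p′∣m m∣n)))
                                              (p∣M p pp (divides m n≡mp)))
    where
    m∣n : m ∣ n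
    m∣n = divides p (trans n≡mp (*-comm m p))
    p∤m : ¬ p ∣ m
    p∤m = squarefree-cofactor sf pp n≡mp
    sf-m : SquareFree m
    sf-m p′ pp′ p′²∣m = sf p′ pp′ (∣-trans p′²∣m m∣n)
    0<m : 0 < m
    0<m = n≢0⇒n>0 (λ { refl → 0≢1+n (sym n≡mp) })
    m<n : m < n
    m<n = subst (m <_) (sym n≡mp) (m<m*n m p {{>-nonZero 0<m}} (prime>1 pp))

2^-split : ∀ a b → a ≤ b → 2 ^ b ≡ 2 ^ a * 2 ^ (b ∸ a)
2^-split a b a≤b = trans (cong (2 ^_) (sym (m+[n∸m]≡n a≤b))) (^-distribˡ-+-* 2 a (b ∸ a))

odd⇒∤2 : ∀ {d} → Odd d → ¬ 2 ∣ d
odd⇒∤2 {d} odd 2∣d = 0≢1+n (trans (sym (n∣m⇒m%n≡0 d 2 2∣d)) odd)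

even-or-odd : ∀ n → 2 ∣ n ⊎ 2 ∣ suc n
even-or-odd zero    = inj₁ (2 ∣0)
even-or-odd (suc n) with even-or-odd n
... | inj₁ (divides k n≡2k) = inj₂ (divides (suc k) (cong (2 +_) n≡2k))
... | inj₂ 2∣n+1            = inj₁ 2∣n+1

TwoAdic : ℕ → Set
TwoAdic m = Σ ℕ λ r → Σ ℕ λ d → m ≡ 2 ^ r * d × Odd d

two-adic-double : ∀ k → TwoAdic k → TwoAdic (k * 2)
two-adic-double k (r , d , k≡ , odd) = suc r , d , (begin
  k * 2             ≡⟨ *-comm k 2 ⟩
  2 * k             ≡⟨ cong (2 *_) k≡ ⟩
  2 * (2 ^ r * d)   ≡⟨ sym (*-assoc 2 (2 ^ r) d) ⟩
  2 ^ suc r * d     ∎) , odd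

two-adic : ∀ m → 0 < m → TwoAdic m
two-adic = <-rec (λ m → 0 < m → TwoAdic m) step
  where
  step : ∀ m → (∀ {k} → k < m → 0 < k → TwoAdic k) → 0 < m → TwoAdic m
  step m rec 0<m with m % 2 in m%2≡ | m%n<n m 2
  ... | 1           | _              = 0 , m , sym (+-identityʳ m) , m%2≡
  ... | suc (suc _) | s≤s (s≤s ())
  ... | 0           | _ with m%n≡0⇒n∣m m 2 m%2≡
  ...   | divides k m≡k2 = subst TwoAdic (sym m≡k2) (two-adic-double k (rec k<m 0<k))
    where
    0<k : 0 < k
    0<k = n≢0⇒n>0 (λ { refl → <⇒≢ 0<m (sym m≡k2) })
    k<m : k < m
    k<m = subst (k <_) (sym m≡k2) (m<m*n k 2 {{>-nonZero 0<k}} (s≤s (s≤s z≤n)))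

pow2-cancel : ∀ z r d P → Odd d → 2 ^ z * P ∣ 2 ^ r * d → P ∣ 2 ^ (r ∸ z) * d
pow2-cancel z r d P odd h with z ≤? r
... | yes z≤r = *-cancelˡ-∣ (2 ^ z) {{m^n≢0 2 z}} (subst (2 ^ z * P ∣_) split h)
  where
  split : 2 ^ r * d ≡ 2 ^ z * (2 ^ (r ∸ z) * d)
  split = trans (cong (_* d) (2^-split z r z≤r)) (*-assoc (2 ^ z) _ d)
... | no z≰r = ⊥-elim (odd⇒∤2 odd (*-cancelˡ-∣ (2 ^ r) {{m^n≢0 2 r}} 2^r2∣2^rd))
  where
  2^r2∣2^z : 2 ^ r * 2 ∣ 2 ^ z
  2^r2∣2^z = divides (2 ^ (z ∸ suc r))
    (trans (2^-split (suc r) z (≰⇒> z≰r)) (trans (*-comm (2 ^ suc r) _) (cong (2 ^ (z ∸ suc r) *_) (*-comm 2 (2 ^ r)))))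
  2^r2∣2^rd : 2 ^ r * 2 ∣ 2 ^ r * d
  2^r2∣2^rd = ∣-trans 2^r2∣2^z (∣-trans (m∣m*n P) h)

pow2-uncancel : ∀ z r d P → Odd d → 2 ∣ P → P ∣ 2 ^ (r ∸ z) * d → 2 ^ z * P ∣ 2 ^ r * d
pow2-uncancel z r d P odd 2∣P h with z ≤? r
... | yes z≤r = subst (2 ^ z * P ∣_) (sym split) (*-monoʳ-∣ (2 ^ z) h)
  where
  split : 2 ^ r * d ≡ 2 ^ z * (2 ^ (r ∸ z) * d)
  split = trans (cong (_* d) (2^-split z r z≤r)) (*-assoc (2 ^ z) _ d)
... | no z≰r = ⊥-elim (odd⇒∤2 odd (∣-trans 2∣P (subst (P ∣_) collapse h)))
  where
  collapse : 2 ^ (r ∸ z) * d ≡ d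
  collapse = trans (cong (λ t → 2 ^ t * d) (m≤n⇒m∸n≡0 (<⇒≤ (≰⇒> z≰r)))) (+-identityʳ d)

window-∣ : ∀ {i r} d → i ≤ r → 2 ^ i * d ∣ 2 ^ r * d
window-∣ {i} {r} d i≤r = *-monoˡ-∣ d (divides (2 ^ (r ∸ i)) (trans (2^-split i r i≤r) (*-comm (2 ^ i) _)))

PassesAll : (z n : ℕ) .{{_ : NonZero n}} → (r d : ℕ) → Set
PassesAll z n r d = ∀ a → 1 ≤ a → a < n → Coprime a n → PassesDeep z n r d a

passes-at-start : ∀ {z n r d a} .{{_ : NonZero n}} → mrTerm n a d (r ∸ z) ≡ 1 % n → PassesDeep z n r d a
passes-at-start {z} {r = r} first≡1 =
  r ∸ z , ≤-refl , m∸n≤m r z , first≡1 , (λ j s≤j j<s → ⊥-elim (<⇒≱ j<s s≤j)) , inj₁ refl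

-- If a ≡ 1 modulo a divisor m ≥ 3 of n, no term of a is ≡ −1 (mod n), so a
-- passing test must already succeed at the first considered term.
pass-forced-to-start : ∀ {z n r d a m} .{{_ : NonZero n}} .{{_ : NonZero m}} →
  m ∣ n → 3 ≤ m → a % m ≡ 1 % m → PassesDeep z n r d a → mrTerm n a d (r ∸ z) ≡ 1 % n
pass-forced-to-start m∣n 3≤m a≡1 (_ , _ , _ , first≡1 , _ , inj₁ refl) = first≡1
pass-forced-to-start {n = n} {d = d} {a} {m} m∣n 3≤m a≡1 (i , _ , _ , _ , _ , inj₂ prev≡-1) =
  ⊥-elim (<⇒≢ (∸-monoˡ-≤ 1 3≤m) (begin
    1                              ≡⟨ sym (m<n⇒m%n≡m (<-trans (s≤s (s≤s z≤n)) 3≤m)) ⟩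
    1 % m                          ≡⟨ sym (^-one-mod (2 ^ (i ∸ 1) * d) a≡1) ⟩
    a ^ (2 ^ (i ∸ 1) * d) % m      ≡⟨ sym (m∣n⇒o%n%m≡o%m m n _ m∣n) ⟩
    mrTerm n a d (i ∸ 1) % m       ≡⟨ cong (_% m) prev≡-1 ⟩
    (n ∸ 1) % n % m                ≡⟨ m∣n⇒o%n%m≡o%m m n (n ∸ 1) m∣n ⟩
    (n ∸ 1) % m                    ≡⟨ pred-mod-divisor (>-nonZero⁻¹ n) m∣n ⟩
    m ∸ 1                          ∎))

fermat-∣ : ∀ {p a e} .{{_ : NonZero p}} → Prime p → ¬ p ∣ a → p ∸ 1 ∣ e → p ∣ a ^ e ∸ 1
fermat-∣ {p} {a} {e} pp p∤a p-1∣e = ≡-mod⇒∣∸ {a = a ^ e} {b = 1}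
  (^-order-∣ (p ∸ 1) {{>-nonZero (m<n⇒0<n∸m (prime>1 pp))}} (fermat pp p∤a) p-1∣e)

-- Sufficiency: under Korselt's condition a^e ≡ 1 (mod n) for every unit a, so
-- every unit base passes at the first considered term.
korselt⇒passes : ∀ {z n r d} .{{_ : NonZero n}} → n ∸ 1 ≡ 2 ^ r * d → Odd d → SquareFree n →
  (∀ p → Prime p → p ∣ n → 2 ^ z * (p ∸ 1) ∣ n ∸ 1) → PassesAll z n r d
korselt⇒passes {z} {n} {r} {d} n-1≡ odd sf korselt a 1≤a _ a⊥n =
  passes-at-start {z = z} (∣∸⇒≡-mod (m^n>0 a {{>-nonZero 1≤a}} e) (squarefree-∣ _ n (>-nonZero⁻¹ n) sf p∣aᵉ-1))
  where
  e : ℕ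
  e = 2 ^ (r ∸ z) * d
  p∣aᵉ-1 : ∀ p → Prime p → p ∣ n → p ∣ a ^ e ∸ 1
  p∣aᵉ-1 p pp p∣n = fermat-∣ {{prime⇒nonZero pp}} pp (λ p∣a → <⇒≢ (prime>1 pp) (sym (a⊥n (p∣a , p∣n))))
                              (pow2-cancel z r d (p ∸ 1) odd (subst (2 ^ z * (p ∸ 1) ∣_) n-1≡ (korselt p pp p∣n)))

one-plus-nilpotent-pow : ∀ {n} .{{_ : NonZero n}} c → n ∣ c * c → ∀ K → suc c ^ K % n ≡ (1 + K * c) % n
one-plus-nilpotent-pow     c n∣c² zero    = refl
one-plus-nilpotent-pow {n} c n∣c² (suc K) = begin
  (suc c * suc c ^ K) % n             ≡⟨ *-cong-mod (suc c) (one-plus-nilpotent-pow c n∣c² K) ⟩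
  (suc c * (1 + K * c)) % n           ≡⟨ cong (_% n) (solve 2 (λ c K → (con 1 :+ c) :* (con 1 :+ K :* c)
                                                                := (con 1 :+ (con 1 :+ K) :* c) :+ K :* (c :* c)) refl c K) ⟩
  ((1 + suc K * c) + K * (c * c)) % n ≡⟨ %-remove-+ʳ (1 + suc K * c) (∣n⇒∣m*n K n∣c²) ⟩
  (1 + suc K * c) % n                 ∎

one-plus-nilpotent-coprime : ∀ {n} c → n ∣ c * c → Coprime (suc c) n
one-plus-nilpotent-coprime c n∣c² {i} (i∣1+c , i∣n) = ∣1⇒≡1 (∣m+n∣m⇒∣n (subst (i ∣_) (+-comm 1 c) i∣1+c) i∣c)
  where
  -- i ∣ c(1 + c) = c + c² and i ∣ c².
  i∣c : i ∣ c
  i∣c = ∣m+n∣m⇒∣n (subst (i ∣_) (trans (*-suc c c) (+-comm c (c * c))) (∣n⇒∣m*n c i∣1+c)) (∣-trans i∣n n∣c²)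

suc<* : ∀ {c p} → 1 < c → 1 < p → suc c < c * p
suc<* {c} {p} 1<c 1<p =
  subst (_< c * p) (+-comm c 1) (<-≤-trans (+-monoʳ-< c 1<c) (subst (_≤ c * p) c2≡c+c (*-monoʳ-≤ c 1<p)))
  where
  c2≡c+c : c * 2 ≡ c + c
  c2≡c+c = solve 1 (λ c → c :* con 2 := c :+ c) refl c

-- Necessity of squarefreeness: if p² ∣ n, the unit base 1 + n/p fails.
deep⇒squarefree : ∀ {z n r d} .{{_ : NonZero n}} → n ∸ 1 ≡ 2 ^ r * d → PassesAll z n r d → SquareFree n
deep⇒squarefree {z} {n} {r} {d} n-1≡ pass p pp (divides k n≡kpp) =
  ∣⇒∤pred pp (divides (k * p) n≡cp) (>-nonZero⁻¹ n) p∣n-1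
  where
  c : ℕ
  c = k * p
  n≡cp : n ≡ c * p
  n≡cp = trans n≡kpp (sym (*-assoc k p p))
  n∣c² : n ∣ c * c
  n∣c² = divides k (trans (solve 2 (λ k p → (k :* p) :* (k :* p) := k :* (k :* (p :* p))) refl k p)
                          (cong (k *_) (sym n≡kpp)))
  c≢0 : c ≢ 0
  c≢0 c≡0 = ≢-nonZero⁻¹ n (trans n≡cp (cong (_* p) c≡0))
  1<c : 1 < c
  1<c = <-≤-trans (prime>1 pp) (m≤n*m p k {{≢-nonZero (λ { refl → c≢0 refl })}})
  1+c<n : suc c < n
  1+c<n = subst (suc c <_) (sym n≡cp) (suc<* 1<c (prime>1 pp))
  -- Some term (1 + c)^K ≡ 1 + K c is 1, so c p = n ∣ K c, p ∣ K, and K ∣ n − 1.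
  p∣n-1 : p ∣ n ∸ 1
  p∣n-1 with pass (suc c) (s≤s z≤n) 1+c<n (one-plus-nilpotent-coprime c n∣c²)
  ... | i , _ , i≤r , term≡1 , _ = ∣-trans p∣K (subst (K ∣_) (sym n-1≡) (window-∣ d i≤r))
    where
    K : ℕ
    K = 2 ^ i * d
    n∣Kc : n ∣ K * c
    n∣Kc = ≡-mod⇒∣∸ {b = 1} (trans (sym (one-plus-nilpotent-pow c n∣c² K)) term≡1)
    p∣K : p ∣ K
    p∣K = *-cancelʳ-∣ c {{≢-nonZero c≢0}} (subst (_∣ K * c) (trans n≡cp (*-comm c p)) n∣Kc)

∣-^ : ∀ m {k} → 0 < k → m ∣ m ^ k
∣-^ m {suc k} _ = m∣m*n (m ^ k)

crt-base : ∀ {m p x} .{{_ : NonZero m}} .{{_ : NonZero p}} → Prime p → ¬ p ∣ m → 0 < x → x < p →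
           Σ ℕ λ a → a < m * p × a % p ≡ x × a % m ≡ 1 % m
crt-base {m} {p} {x} pp p∤m 0<x x<p = a₀ % (m * p) , m%n<n a₀ (m * p) , a≡x , a≡1
  where
  instance
    mp-nonZero : NonZero (m * p)
    mp-nonZero = m*n≢0 m p
  a₀ : ℕ
  a₀ = 1 + m ^ (p ∸ 1) * (x ∸ 1)
  a≡x : a₀ % (m * p) % p ≡ x
  a≡x = begin
    a₀ % (m * p) % p   ≡⟨ m∣n⇒o%n%m≡o%m p (m * p) a₀ (n∣m*n m) ⟩
    a₀ % p             ≡⟨ +-cong-mod 1 (*-one-mod (x ∸ 1) (fermat pp p∤m)) ⟩
    (1 + (x ∸ 1)) % p  ≡⟨ cong (_% p) (m+[n∸m]≡n 0<x) ⟩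
    x % p              ≡⟨ m<n⇒m%n≡m x<p ⟩
    x                  ∎
  a≡1 : a₀ % (m * p) % m ≡ 1 % m
  a≡1 = trans (m∣n⇒o%n%m≡o%m m (m * p) a₀ (m∣m*n p))
              (%-remove-+ʳ 1 (∣m⇒∣m*n (x ∸ 1) (∣-^ m (m<n⇒0<n∸m (prime>1 pp)))))

cofactor≥3 : ∀ {n m p} → Odd n → Composite n → Prime p → n ≡ m * p → 3 ≤ m
cofactor≥3 {m = 0}             ()  _    _  refl
cofactor≥3 {m = 1} {p}         _   comp pp n≡p  = ⊥-elim (composite⇒¬prime comp (subst Prime (sym (trans n≡p (*-identityˡ p))) pp))
cofactor≥3 {m = 2} {p}         odd _    _  n≡2p = ⊥-elim (odd⇒∤2 odd (divides p (trans n≡2p (*-comm 2 p))))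
cofactor≥3 {m = suc (suc (suc _))} _ _ _ _      = s≤s (s≤s (s≤s z≤n))

-- Every nonzero residue x mod p satisfies x^e ≡ 1 (mod p), e = 2^(r∸z) d: test the
-- Chinese-remainder base a ≡ x (mod p), a ≡ 1 (mod m), which must pass at its first term.
nonzero-residues-power≡1 : ∀ {z n r d m p} .{{_ : NonZero n}} .{{_ : NonZero p}} → PassesAll z n r d →
  Prime p → n ≡ m * p → ¬ p ∣ m → 3 ≤ m → ∀ x → 0 < x → x < p → x ^ (2 ^ (r ∸ z) * d) % p ≡ 1 % p
nonzero-residues-power≡1 {z} {n} {r} {d} {m} {p} pass pp n≡mp p∤m 3≤m x 0<x x<p = from-base (crt-base pp p∤m 0<x x<p)
  where
  instance
    m-nonZero : NonZero m
    m-nonZero = >-nonZero (≤-trans (s≤s z≤n) 3≤m)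
  e : ℕ
  e = 2 ^ (r ∸ z) * d
  p∣n : p ∣ n
  p∣n = divides m n≡mp
  m∣n : m ∣ n
  m∣n = divides p (trans n≡mp (*-comm m p))
  from-base : (Σ ℕ λ a → a < m * p × a % p ≡ x × a % m ≡ 1 % m) → x ^ e % p ≡ 1 % p
  from-base (a , a<mp , a≡x , a≡1) = begin
    x ^ e % p          ≡⟨ cong (λ t → t ^ e % p) (sym a≡x) ⟩
    (a % p) ^ e % p    ≡⟨ ^-%-absorb a e ⟩
    a ^ e % p          ≡⟨ sym (m∣n⇒o%n%m≡o%m p n (a ^ e) p∣n) ⟩
    a ^ e % n % p      ≡⟨ cong (_% p) first≡1 ⟩
    1 % n % p          ≡⟨ m∣n⇒o%n%m≡o%m p n 1 p∣n ⟩
    1 % p              ∎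
    where
    a<n : a < n
    a<n = subst (a <_) (sym n≡mp) a<mp
    p∤a : ¬ p ∣ a
    p∤a p∣a = <⇒≢ 0<x (trans (sym (n∣m⇒m%n≡0 a p p∣a)) a≡x)
    1≤a : 1 ≤ a
    1≤a = n≢0⇒n>0 (λ { refl → p∤a (p ∣0) })
    a⊥n : Coprime a n
    a⊥n = subst (Coprime a) (sym n≡mp) (coprime-* (≡1-mod⇒coprime {m = m} a≡1) (∤⇒coprime pp p∤a))
    first≡1 : a ^ e % n ≡ 1 % n
    first≡1 = pass-forced-to-start {z = z} m∣n 3≤m a≡1 (pass a 1≤a a<n a⊥n)

-- Necessity of the divisibility condition: (p − 1) ∣ e by the power-sum lemma, and
-- p − 1 is even, so 2^z (p − 1) ∣ 2^r d = n − 1.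
deep⇒divisibility : ∀ {z n r d} .{{_ : NonZero n}} → Odd n → Composite n → n ∸ 1 ≡ 2 ^ r * d → Odd d →
  PassesAll z n r d → SquareFree n → ∀ p → Prime p → p ∣ n → 2 ^ z * (p ∸ 1) ∣ n ∸ 1
deep⇒divisibility {z} {n} {r} {d} odd-n comp n-1≡ odd-d pass sf p pp (divides m n≡mp) =
  subst (2 ^ z * (p ∸ 1) ∣_) (sym n-1≡)
    (pow2-uncancel z r d (p ∸ 1) odd-d p-1-even
      (units-exponent pp (nonzero-residues-power≡1 {z = z} pass pp n≡mp p∤m (cofactor≥3 odd-n comp pp n≡mp))))
  where
  instance
    p-nonZero : NonZero p
    p-nonZero = prime⇒nonZero pp
  p∤m : ¬ p ∣ m
  p∤m = squarefree-cofactor sf pp n≡mp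
  -- p is odd since it divides the odd n.
  p-1-even : 2 ∣ p ∸ 1
  p-1-even with prime-suc pp | even-or-odd (p ∸ 1)
  ... | q , refl | inj₁ 2∣q   = 2∣q
  ... | q , refl | inj₂ 2∣q+1 = ⊥-elim (odd⇒∤2 odd-n (∣-trans 2∣q+1 (divides m n≡mp)))

proposition3p1 : (z n : ℕ) .{{_ : NonZero n}} → 1 < n → Odd n → Composite n →
    (DeepCarmichael z n ⇔ (SquareFree n × (∀ p → Prime p → p ∣ n → (2 ^ z * (p ∸ 1)) ∣ (n ∸ 1))))
proposition3p1 z n 1<n odd-n comp-n = mk⇔ necessity sufficiency
  where
  necessity : DeepCarmichael z n → SquareFree n × (∀ p → Prime p → p ∣ n → 2 ^ z * (p ∸ 1) ∣ n ∸ 1)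
  necessity (_ , _ , pass) with two-adic (n ∸ 1) (m<n⇒0<n∸m 1<n)
  ... | r , d , n-1≡ , odd-d = squarefree , deep⇒divisibility {z = z} odd-n comp-n n-1≡ odd-d passes squarefree
    where
    passes : PassesAll z n r d
    passes = pass r d n-1≡ odd-d
    squarefree : SquareFree n
    squarefree = deep⇒squarefree {z = z} n-1≡ passes
  sufficiency : SquareFree n × (∀ p → Prime p → p ∣ n → 2 ^ z * (p ∸ 1) ∣ n ∸ 1) → DeepCarmichael z n
  sufficiency (sf , korselt) = odd-n , comp-n , λ r d n-1≡ odd-d → korselt⇒passes {z = z} n-1≡ odd-d sf korselt
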